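{- If the triple $(a,b,c)$ of positive integers is good, then $a\geq b$ and $a\geq c$.
   Context: For positive integers $a,b,c$ with $n=a+b+c$, the permutation of the triple $(a,b,c)$ is the permutation of $[n]$ with $p_i=n+1-i$ for $1\le i\le a$, $p_i=a+b+1-i$ for $a+1\le i\le a+b$, and $p_i=n+b+1-i$ for $a+b+1\le i\le n$ (one-line notation $n\cdots(n-a+1)\ b\cdots1\ (b+c)\cdots(b+1)$). The triple is good if this permutation, as a bijection $i\mapsto p_i$ of $[n]$, is a single $n$-cycle. -}

module Defs where

open import Data.Nat using (ℕ; zero; suc; _+_; _∸_; _≤_; _<_; _≤ᵇ_)
open import Data.Bool using (if_then_else_)
open import Data.Product using (∃-syntax)
open import Relation.Binary.PropositionalEquality using (_≡_)

-- The permutation of the triple (a,b,c) on [n] = {1,…,n}, n = a+b+c: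
--   p i = n+1-i      for 1 ≤ i ≤ a
--   p i = a+b+1-i    for a+1 ≤ i ≤ a+b
--   p i = n+b+1-i    for a+b+1 ≤ i ≤ n
-- (values outside [1,n] are irrelevant; they are never used below).
tripPerm : ℕ → ℕ → ℕ → ℕ → ℕ
tripPerm a b c i =
  if i ≤ᵇ a then (a + b + c + 1) ∸ i
  else if i ≤ᵇ a + b then (a + b + 1) ∸ i
  else (a + b + c + b + 1) ∸ i

iter : (ℕ → ℕ) → ℕ → ℕ → ℕ
iter f zero x = x
iter f (suc k) x = f (iter f k x)

-- A bijection p of [n] = {1,…,n} is a single n-cycle iff it acts
-- transitively on [n]: every j ∈ [n] lies in the orbit of every i ∈ [n].
IsSingleCycle : ℕ → (ℕ → ℕ) → Set
IsSingleCycle n p =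
  ∀ i j → 1 ≤ i → i ≤ n → 1 ≤ j → j ≤ n → ∃[ k ] iter p k i ≡ j

Good : ℕ → ℕ → ℕ → Set
Good a b c = IsSingleCycle (a + b + c) (tripPerm a b c)

module Submission where

-- If a < b, the permutation of (a,b,c) reverses the middle block
-- {a+1,…,a+b} and so swaps its endpoints a+1 and b: these form an orbit of
-- size at most two, which misses n = a+b+c.  If a < c, the permutation maps
-- the last block {a+b+1,…,n} onto {b+1,…,b+c} reversing it, and since
-- b+c > a+b it swaps a+b+1 and b+c, an orbit that misses 1.  In both cases
-- the permutation is not transitive on [n], i.e. the triple is not good.

open import Defs
open import Data.Nat using (ℕ; _≤_; _≥_)
open import Data.Product using (_×_)
open import Data.Nat.Base
open import Data.Nat.Properties
open import Data.Bool using (true; false; T)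
open import Data.Bool.Properties using (T-≡)
open import Data.Product using (_,_; proj₁; proj₂)
open import Data.Sum using (_⊎_; inj₁; inj₂)
open import Function.Bundles using (Equivalence)
open import Relation.Nullary using (¬_; contradiction)
open import Relation.Binary.PropositionalEquality
open import Data.Nat.Tactic.RingSolver using (solve-∀)

≤⇒≤ᵇ≡true : ∀ {m n} → m ≤ n → (m ≤ᵇ n) ≡ true
≤⇒≤ᵇ≡true m≤n = Equivalence.to T-≡ (≤⇒≤ᵇ m≤n)

>⇒≤ᵇ≡false : ∀ {m n} → n < m → (m ≤ᵇ n) ≡ false
>⇒≤ᵇ≡false {m} {n} n<m with m ≤ᵇ n in eq
... | true  = contradiction (≤ᵇ⇒≤ m n (subst T (sym eq) _)) (<⇒≱ n<m)
... | false = refl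

∸-of-sum : ∀ {k n m} → k + n ≡ m → m ∸ n ≡ k
∸-of-sum {k} {n} refl = m+n∸n≡m k n

tripPerm-middle : ∀ a b c i → a < i → i ≤ a + b →
  tripPerm a b c i ≡ a + b + 1 ∸ i
tripPerm-middle a b c i a<i i≤a+b
  rewrite >⇒≤ᵇ≡false a<i | ≤⇒≤ᵇ≡true i≤a+b = refl

tripPerm-last : ∀ a b c i → a + b < i →
  tripPerm a b c i ≡ a + b + c + b + 1 ∸ i
tripPerm-last a b c i a+b<i
  rewrite >⇒≤ᵇ≡false {i} {a} (≤-<-trans (m≤m+n a b) a+b<i)
        | >⇒≤ᵇ≡false a+b<i = refl

swap-orbit : ∀ (p : ℕ → ℕ) {x y} → p x ≡ y → p y ≡ x →
  ∀ k → iter p k x ≡ x ⊎ iter p k x ≡ y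
swap-orbit p px≡y py≡x zero = inj₁ refl
swap-orbit p px≡y py≡x (suc k) with swap-orbit p px≡y py≡x k
... | inj₁ at-x = inj₂ (trans (cong p at-x) px≡y)
... | inj₂ at-y = inj₁ (trans (cong p at-y) py≡x)

swap-not-single-cycle : ∀ n (p : ℕ → ℕ) {x y} j →
  p x ≡ y → p y ≡ x → 1 ≤ x → x ≤ n → 1 ≤ j → j ≤ n →
  x ≢ j → y ≢ j → ¬ IsSingleCycle n p
swap-not-single-cycle n p j px≡y py≡x 1≤x x≤n 1≤j j≤n x≢j y≢j cyc
  with cyc _ j 1≤x x≤n 1≤j j≤n
... | k , reaches with swap-orbit p px≡y py≡x k
...   | inj₁ at-x = x≢j (trans (sym at-x) reaches)
...   | inj₂ at-y = y≢j (trans (sym at-y) reaches)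

middle-swap : ∀ a b c → a < b →
  tripPerm a b c (suc a) ≡ b × tripPerm a b c b ≡ suc a
middle-swap a b c a<b =
    trans (tripPerm-middle a b c (suc a) ≤-refl (≤-trans a<b (m≤n+m b a)))
          (∸-of-sum (b+[1+a]≡a+b+1 a b))
  , trans (tripPerm-middle a b c b a<b (m≤n+m b a))
          (∸-of-sum ([1+a]+b≡a+b+1 a b))
  where
  b+[1+a]≡a+b+1 : ∀ a b → b + suc a ≡ a + b + 1
  b+[1+a]≡a+b+1 = solve-∀
  [1+a]+b≡a+b+1 : ∀ a b → suc a + b ≡ a + b + 1
  [1+a]+b≡a+b+1 = solve-∀

-- If a < c, the last block is mapped reversed onto {b+1,…,b+c}, which
-- lies inside the last block; hence a+b+1 and b+c are swapped.
last-swap : ∀ a b c → a < c →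
  tripPerm a b c (a + b + 1) ≡ b + c × tripPerm a b c (b + c) ≡ a + b + 1
last-swap a b c a<c =
    trans (tripPerm-last a b c (a + b + 1) (m<m+n (a + b) z<1))
          (∸-of-sum (b+c+[a+b+1]≡n+b+1 a b c))
  , trans (tripPerm-last a b c (b + c) a+b<b+c)
          (∸-of-sum ([a+b+1]+[b+c]≡n+b+1 a b c))
  where
  z<1 : 0 < 1
  z<1 = s≤s z≤n
  a+b<b+c : a + b < b + c
  a+b<b+c = subst (_< b + c) (+-comm b a) (+-monoʳ-< b a<c)
  b+c+[a+b+1]≡n+b+1 : ∀ a b c → b + c + (a + b + 1) ≡ a + b + c + b + 1
  b+c+[a+b+1]≡n+b+1 = solve-∀
  [a+b+1]+[b+c]≡n+b+1 : ∀ a b c → a + b + 1 + (b + c) ≡ a + b + c + b + 1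
  [a+b+1]+[b+c]≡n+b+1 = solve-∀

not-good-if-a<b : ∀ a b c → 1 ≤ c → a < b → ¬ Good a b c
not-good-if-a<b a b c 1≤c a<b =
  swap-not-single-cycle n (tripPerm a b c) n px≡y py≡x
    (s≤s z≤n) (<⇒≤ 1+a<n) (≤-trans (s≤s z≤n) b<n) ≤-refl
    (<⇒≢ 1+a<n) (<⇒≢ b<n)
  where
  n : ℕ
  n = a + b + c
  px≡y : tripPerm a b c (suc a) ≡ b
  px≡y = proj₁ (middle-swap a b c a<b)
  py≡x : tripPerm a b c b ≡ suc a
  py≡x = proj₂ (middle-swap a b c a<b)
  b<n : b < n
  b<n = ≤-<-trans (m≤n+m b a) (m<m+n (a + b) 1≤c)
  1+a<n : suc a < n
  1+a<n = ≤-<-trans a<b b<n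

not-good-if-a<c : ∀ a b c → 1 ≤ b → a < c → ¬ Good a b c
not-good-if-a<c a b c 1≤b a<c =
  swap-not-single-cycle (a + b + c) (tripPerm a b c) 1 px≡y py≡x
    1≤x x≤n ≤-refl (≤-trans 1≤x x≤n)
    (≢-sym (<⇒≢ 1<a+b+1)) (≢-sym (<⇒≢ 1<b+c))
  where
  px≡y : tripPerm a b c (a + b + 1) ≡ b + c
  px≡y = proj₁ (last-swap a b c a<c)
  py≡x : tripPerm a b c (b + c) ≡ a + b + 1
  py≡x = proj₂ (last-swap a b c a<c)
  1≤x : 1 ≤ a + b + 1
  1≤x = m≤n+m 1 (a + b)
  x≤n : a + b + 1 ≤ a + b + c
  x≤n = +-monoʳ-≤ (a + b) (≤-trans (s≤s z≤n) a<c)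
  1<a+b+1 : 1 < a + b + 1
  1<a+b+1 = +-monoˡ-< 1 (≤-trans 1≤b (m≤n+m b a))
  1<b+c : 1 < b + c
  1<b+c = +-mono-≤-< 1≤b (≤-<-trans z≤n a<c)

proposition5 : (a b c : ℕ) → 1 ≤ a → 1 ≤ b → 1 ≤ c →
    Good a b c → (a ≥ b) × (a ≥ c)
proposition5 a b c _ 1≤b 1≤c good =
    ≮⇒≥ (λ a<b → not-good-if-a<b a b c 1≤c a<b good)
  , ≮⇒≥ (λ a<c → not-good-if-a<c a b c 1≤b a<c good)
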